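{- Let $n\ge 3$. If $A$ is an extreme point of $\mathcal{L}_n$ all of whose entries lie in $\{0,1\}$, then $\frac{1}{n}A$ is not an extreme point of $\mathcal{P}_n$.
   Context: $\mathcal{L}_n\subset\mathbb{R}^{n^3}$ is the polytope of $n\times n\times n$ line-stochastic tensors: real arrays $A=(a_{ijk})$, $1\le i,j,k\le n$, with $a_{ijk}\ge 0$, $\sum_i a_{ijk}=1$ for all $j,k$, $\sum_j a_{ijk}=1$ for all $i,k$, $\sum_k a_{ijk}=1$ for all $i,j$. $\mathcal{P}_n\subset\mathbb{R}^{n^3}$ is the polytope of $n\times n\times n$ plane-stochastic tensors: nonnegative $A=(a_{ijk})$ with $\sum_{i,j}a_{ijk}=1$ for all $k$, $\sum_{j,k}a_{ijk}=1$ for all $i$, $\sum_{i,k}a_{ijk}=1$ for all $j$.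
   Formalization: Tensor entries, including those of the tensors tested in the definition of an extreme point of $\mathcal{L}_n$ and $\mathcal{P}_n$, are taken in ℚ rather than ℝ. -}

module Defs where

open import Data.Nat using (ℕ; zero; suc)
open import Data.Fin using (Fin; zero; suc)
open import Data.Integer using (+_)
open import Data.Rational using (ℚ; 0ℚ; 1ℚ; _+_; _*_; _-_; _≤_; _<_; _/_)
open import Data.Product using (_×_; Σ; ∃)
open import Relation.Binary.PropositionalEquality using (_≡_)
open import Relation.Nullary using (¬_)

Tensor : ℕ → Set
Tensor n = Fin n → Fin n → Fin n → ℚ

∑ : ∀ n → (Fin n → ℚ) → ℚ
∑ zero    f = 0ℚ
∑ (suc n) f = f zero + ∑ n (λ i → f (suc i))

Nonneg : ∀ {n} → Tensor n → Set
Nonneg {n} A = ∀ i j k → 0ℚ ≤ A i j k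

LineStochastic : ∀ n → Tensor n → Set
LineStochastic n A =
  Nonneg A ×
  (∀ j k → ∑ n (λ i → A i j k) ≡ 1ℚ) ×
  (∀ i k → ∑ n (λ j → A i j k) ≡ 1ℚ) ×
  (∀ i j → ∑ n (λ k → A i j k) ≡ 1ℚ)

PlaneStochastic : ∀ n → Tensor n → Set
PlaneStochastic n A =
  Nonneg A ×
  (∀ k → ∑ n (λ i → ∑ n (λ j → A i j k)) ≡ 1ℚ) ×
  (∀ i → ∑ n (λ j → ∑ n (λ k → A i j k)) ≡ 1ℚ) ×
  (∀ j → ∑ n (λ i → ∑ n (λ k → A i j k)) ≡ 1ℚ)

IsExtreme : ∀ n → (Tensor n → Set) → Tensor n → Set
IsExtreme n K x =
  K x ×
  (∀ (y z : Tensor n) (t : ℚ) → K y → K z → 0ℚ < t → t < 1ℚ →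
     (∀ i j k → x i j k ≡ t * y i j k + (1ℚ - t) * z i j k) →
     ∀ i j k → y i j k ≡ z i j k)

-- 1/n as a rational (value at n = 0 irrelevant; only used for n ≥ 3)
inv : ℕ → ℚ
inv zero    = 0ℚ
inv (suc m) = + 1 / suc m

scale : ∀ {n} → ℚ → Tensor n → Tensor n
scale c A i j k = c * A i j k

ZeroOne : ∀ {n} → Tensor n → Set
ZeroOne {n} A = ∀ i j k → (A i j k ≡ 0ℚ) Data.Sum.⊎ (A i j k ≡ 1ℚ)
  where import Data.Sum

-- Put x = A/n. For any f with ∑ f = 0 let φ_k = ∑_{ij} A_{ijk} f_i f_j and
-- w_{ijk} = A_{ijk} (n f_i f_j − φ_k). Every slice of a line-stochastic A is doubly
-- stochastic, and this makes all plane sums of w vanish. For f = e₀ − e₁ and A with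
-- entries in {0,1} we have |f_i f_j| ≤ 1 and |φ_k| ≤ 2 < n, so for d = w/(2n²) both
-- x ± d are nonnegative, hence plane-stochastic, while d ≠ 0 at any (0,0,k) with
-- A_{00k} = 1. So x is the midpoint of two distinct points of P_n.

module Submission where

open import Defs
open import Data.Nat using (ℕ; _≤_; zero; suc; s≤s; z≤n)
open import Data.Fin using (Fin; zero; suc)
open import Data.Rational using (ℚ; 0ℚ; 1ℚ; ½; _+_; _*_; _-_; -_; _<_)
import Data.Rational as ℚ
import Data.Rational.Properties as ℚ
open import Data.Rational.Solver using (module +-*-Solver)
open +-*-Solver
open import Data.Product using (_×_; _,_; proj₁; proj₂; Σ-syntax)
open import Data.Sum using (_⊎_; inj₁; inj₂)
open import Relation.Nullary using (¬_)
open import Relation.Nullary.Decidable using (True; toWitness)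
open import Function using (_∘_)
open import Relation.Binary.PropositionalEquality
open ≡-Reasoning

∑-cong : ∀ n {g h : Fin n → ℚ} → (∀ i → g i ≡ h i) → ∑ n g ≡ ∑ n h
∑-cong zero    eq = refl
∑-cong (suc n) eq = cong₂ _+_ (eq zero) (∑-cong n (λ i → eq (suc i)))

∑-zero : ∀ n → ∑ n (λ _ → 0ℚ) ≡ 0ℚ
∑-zero zero    = refl
∑-zero (suc n) = cong (0ℚ +_) (∑-zero n)

∑-+ : ∀ n (g h : Fin n → ℚ) → ∑ n (λ i → g i + h i) ≡ ∑ n g + ∑ n h
∑-+ zero    g h = refl
∑-+ (suc n) g h = begin
  (g zero + h zero) + ∑ n (λ i → g (suc i) + h (suc i))
    ≡⟨ cong ((g zero + h zero) +_) (∑-+ n (λ i → g (suc i)) (λ i → h (suc i))) ⟩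
  (g zero + h zero) + (∑ n (λ i → g (suc i)) + ∑ n (λ i → h (suc i)))
    ≡⟨ solve 4 (λ a b G H → (a :+ b) :+ (G :+ H) := (a :+ G) :+ (b :+ H)) refl
         (g zero) (h zero) (∑ n (λ i → g (suc i))) (∑ n (λ i → h (suc i))) ⟩
  (g zero + ∑ n (λ i → g (suc i))) + (h zero + ∑ n (λ i → h (suc i))) ∎

∑-*ˡ : ∀ n a (g : Fin n → ℚ) → ∑ n (λ i → a * g i) ≡ a * ∑ n g
∑-*ˡ zero    a g = sym (ℚ.*-zeroʳ a)
∑-*ˡ (suc n) a g = begin
  a * g zero + ∑ n (λ i → a * g (suc i)) ≡⟨ cong (a * g zero +_) (∑-*ˡ n a (λ i → g (suc i))) ⟩
  a * g zero + a * ∑ n (λ i → g (suc i)) ≡⟨ ℚ.*-distribˡ-+ a (g zero) _ ⟨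
  a * (g zero + ∑ n (λ i → g (suc i)))   ∎

∑-neg : ∀ n (g : Fin n → ℚ) → ∑ n (λ i → - g i) ≡ - ∑ n g
∑-neg zero    g = refl
∑-neg (suc n) g = trans (cong (- g zero +_) (∑-neg n (λ i → g (suc i))))
                        (sym (ℚ.neg-distrib-+ (g zero) _))

∑-- : ∀ n (g h : Fin n → ℚ) → ∑ n (λ i → g i - h i) ≡ ∑ n g - ∑ n h
∑-- n g h = trans (∑-+ n g (λ i → - h i)) (cong (∑ n g +_) (∑-neg n h))

∑-comm : ∀ n m (G : Fin n → Fin m → ℚ) →
  ∑ n (λ i → ∑ m (G i)) ≡ ∑ m (λ j → ∑ n (λ i → G i j))
∑-comm zero    m G = sym (∑-zero m)
∑-comm (suc n) m G = begin
  ∑ m (G zero) + ∑ n (λ i → ∑ m (G (suc i)))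
    ≡⟨ cong (∑ m (G zero) +_) (∑-comm n m (λ i → G (suc i))) ⟩
  ∑ m (G zero) + ∑ m (λ j → ∑ n (λ i → G (suc i) j))
    ≡⟨ ∑-+ m (G zero) (λ j → ∑ n (λ i → G (suc i) j)) ⟨
  ∑ m (λ j → G zero j + ∑ n (λ i → G (suc i) j)) ∎

∑≡1⇒∃≡1 : ∀ n (g : Fin n → ℚ) → (∀ i → g i ≡ 0ℚ ⊎ g i ≡ 1ℚ) → ∑ n g ≡ 1ℚ →
  Σ[ i ∈ Fin n ] g i ≡ 1ℚ
∑≡1⇒∃≡1 (suc n) g g01 sum≡1 with g01 zero
... | inj₂ g₀≡1 = zero , g₀≡1
... | inj₁ g₀≡0 with ∑≡1⇒∃≡1 n (λ i → g (suc i)) (λ i → g01 (suc i)) tail≡1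
  where
  tail≡1 : ∑ n (λ i → g (suc i)) ≡ 1ℚ
  tail≡1 = begin
    ∑ n (λ i → g (suc i))          ≡⟨ ℚ.+-identityˡ _ ⟨
    0ℚ + ∑ n (λ i → g (suc i))     ≡⟨ cong (_+ ∑ n (λ i → g (suc i))) g₀≡0 ⟨
    g zero + ∑ n (λ i → g (suc i)) ≡⟨ sum≡1 ⟩
    1ℚ                             ∎
... | i , gi≡1 = suc i , gi≡1

decide-≤ : ∀ {p q} {p≤?q : True (p ℚ.≤? q)} → p ℚ.≤ q
decide-≤ {p≤?q = p≤?q} = toWitness p≤?q

decide-< : ∀ {p q} {p<?q : True (p ℚ.<? q)} → p < q
decide-< {p<?q = p<?q} = toWitness p<?q

*-nonNeg : ∀ {p q} → 0ℚ ℚ.≤ p → 0ℚ ℚ.≤ q → 0ℚ ℚ.≤ p * q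
*-nonNeg {p} {q} 0≤p 0≤q = ℚ.nonNegative⁻¹ (p * q)
  {{ℚ.nonNeg*nonNeg⇒nonNeg p {{ℚ.nonNegative 0≤p}} q {{ℚ.nonNegative 0≤q}}}}

*-pos : ∀ {p q} → 0ℚ < p → 0ℚ < q → 0ℚ < p * q
*-pos {p} {q} 0<p 0<q = ℚ.positive⁻¹ (p * q)
  {{ℚ.pos*pos⇒pos p {{ℚ.positive 0<p}} q {{ℚ.positive 0<q}}}}

+≡-⇒≡0 : ∀ p q → p + q ≡ p - q → q ≡ 0ℚ
+≡-⇒≡0 p q p+q≡p-q = begin
  q                         ≡⟨ solve 2 (λ p q → q := con ½ :* ((p :+ q) :- (p :- q))) refl p q ⟩
  ½ * ((p + q) - (p - q))   ≡⟨ cong (λ r → ½ * (r - (p - q))) p+q≡p-q ⟩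
  ½ * ((p - q) - (p - q))   ≡⟨ cong (½ *_) (ℚ.+-inverseʳ (p - q)) ⟩
  0ℚ                        ∎

∑₂ : ∀ n → (Fin n → Fin n → ℚ) → ℚ
∑₂ n G = ∑ n (λ p → ∑ n (G p))

∑₂-cong : ∀ n {G H : Fin n → Fin n → ℚ} → (∀ p q → G p q ≡ H p q) → ∑₂ n G ≡ ∑₂ n H
∑₂-cong n eq = ∑-cong n (λ p → ∑-cong n (eq p))

∑₂-+ : ∀ n (G H : Fin n → Fin n → ℚ) → ∑₂ n (λ p q → G p q + H p q) ≡ ∑₂ n G + ∑₂ n H
∑₂-+ n G H = trans (∑-cong n (λ p → ∑-+ n (G p) (H p)))
                   (∑-+ n (λ p → ∑ n (G p)) (λ p → ∑ n (H p)))

∑₂-- : ∀ n (G H : Fin n → Fin n → ℚ) → ∑₂ n (λ p q → G p q - H p q) ≡ ∑₂ n G - ∑₂ n H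
∑₂-- n G H = trans (∑-cong n (λ p → ∑-- n (G p) (H p)))
                   (∑-- n (λ p → ∑ n (G p)) (λ p → ∑ n (H p)))

∑₂-neg : ∀ n (G : Fin n → Fin n → ℚ) → ∑₂ n (λ p q → - G p q) ≡ - ∑₂ n G
∑₂-neg n G = trans (∑-cong n (λ p → ∑-neg n (G p))) (∑-neg n (λ p → ∑ n (G p)))

∑₂-*ˡ : ∀ n a (G : Fin n → Fin n → ℚ) → ∑₂ n (λ p q → a * G p q) ≡ a * ∑₂ n G
∑₂-*ˡ n a G = trans (∑-cong n (λ p → ∑-*ˡ n a (G p))) (∑-*ˡ n a (λ p → ∑ n (G p)))

∑₂-rowStochastic : ∀ n (B : Fin n → Fin n → ℚ) (g : Fin n → ℚ) →
  (∀ p → ∑ n (B p) ≡ 1ℚ) → ∑₂ n (λ p q → g p * B p q) ≡ ∑ n g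
∑₂-rowStochastic n B g rows = ∑-cong n λ p → begin
  ∑ n (λ q → g p * B p q) ≡⟨ ∑-*ˡ n (g p) (B p) ⟩
  g p * ∑ n (B p)         ≡⟨ cong (g p *_) (rows p) ⟩
  g p * 1ℚ                ≡⟨ ℚ.*-identityʳ (g p) ⟩
  g p                     ∎

∑₂-columnStochastic : ∀ n (B : Fin n → Fin n → ℚ) (ψ : Fin n → ℚ) →
  (∀ q → ∑ n (λ p → B p q) ≡ 1ℚ) → ∑₂ n (λ p q → ψ q * B p q) ≡ ∑ n ψ
∑₂-columnStochastic n B ψ columns =
  trans (∑-comm n n (λ p q → ψ q * B p q))
        (∑₂-rowStochastic n (λ q p → B p q) ψ columns)

∑₂-doublyStochastic : ∀ n (B : Fin n → Fin n → ℚ) (g ψ : Fin n → ℚ) →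
  (∀ p → ∑ n (B p) ≡ 1ℚ) → (∀ q → ∑ n (λ p → B p q) ≡ 1ℚ) →
  ∑₂ n (λ p q → B p q * (g p - ψ q)) ≡ ∑ n g - ∑ n ψ
∑₂-doublyStochastic n B g ψ rows columns = begin
  ∑₂ n (λ p q → B p q * (g p - ψ q))
    ≡⟨ ∑₂-cong n (λ p q → solve 3 (λ b x y → b :* (x :- y) := x :* b :- y :* b) refl
                                  (B p q) (g p) (ψ q)) ⟩
  ∑₂ n (λ p q → g p * B p q - ψ q * B p q)
    ≡⟨ ∑₂-- n (λ p q → g p * B p q) (λ p q → ψ q * B p q) ⟩
  ∑₂ n (λ p q → g p * B p q) - ∑₂ n (λ p q → ψ q * B p q)
    ≡⟨ cong₂ _-_ (∑₂-rowStochastic n B g rows) (∑₂-columnStochastic n B ψ columns) ⟩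
  ∑ n g - ∑ n ψ ∎

ZeroPlaneSums : ∀ n → Tensor n → Set
ZeroPlaneSums n d =
  (∀ k → ∑₂ n (λ i j → d i j k) ≡ 0ℚ) ×
  (∀ i → ∑₂ n (λ j k → d i j k) ≡ 0ℚ) ×
  (∀ j → ∑₂ n (λ i k → d i j k) ≡ 0ℚ)

zeroPlaneSums-scale : ∀ {n} a {d : Tensor n} → ZeroPlaneSums n d → ZeroPlaneSums n (scale a d)
zeroPlaneSums-scale {n} a {d} (zk , zi , zj) =
  (λ k → scaled (λ i j → d i j k) (zk k)) ,
  (λ i → scaled (λ j k → d i j k) (zi i)) ,
  (λ j → scaled (λ i k → d i j k) (zj j))
  where
  scaled : ∀ G → ∑₂ n G ≡ 0ℚ → ∑₂ n (λ p q → a * G p q) ≡ 0ℚ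
  scaled G ∑G≡0 = trans (∑₂-*ˡ n a G) (trans (cong (a *_) ∑G≡0) (ℚ.*-zeroʳ a))

zeroPlaneSums-neg : ∀ {n} {d : Tensor n} → ZeroPlaneSums n d →
  ZeroPlaneSums n (λ i j k → - d i j k)
zeroPlaneSums-neg {n} {d} (zk , zi , zj) =
  (λ k → negated (λ i j → d i j k) (zk k)) ,
  (λ i → negated (λ j k → d i j k) (zi i)) ,
  (λ j → negated (λ i k → d i j k) (zj j))
  where
  negated : ∀ G → ∑₂ n G ≡ 0ℚ → ∑₂ n (λ p q → - G p q) ≡ 0ℚ
  negated G ∑G≡0 = trans (∑₂-neg n G) (cong -_ ∑G≡0)

_⊕_ : ∀ {n} → Tensor n → Tensor n → Tensor n
(x ⊕ d) i j k = x i j k + d i j k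

_⊖_ : ∀ {n} → Tensor n → Tensor n → Tensor n
(x ⊖ d) i j k = x i j k - d i j k

planeStochastic-⊕ : ∀ {n} {x d : Tensor n} → PlaneStochastic n x → ZeroPlaneSums n d →
  Nonneg (x ⊕ d) → PlaneStochastic n (x ⊕ d)
planeStochastic-⊕ {n} {x} {d} (_ , xk , xi , xj) (dk , di , dj) x⊕d≥0 =
  x⊕d≥0 ,
  (λ k → shifted (λ i j → x i j k) (λ i j → d i j k) (xk k) (dk k)) ,
  (λ i → shifted (λ j k → x i j k) (λ j k → d i j k) (xi i) (di i)) ,
  (λ j → shifted (λ i k → x i j k) (λ i k → d i j k) (xj j) (dj j))
  where
  shifted : ∀ X D → ∑₂ n X ≡ 1ℚ → ∑₂ n D ≡ 0ℚ → ∑₂ n (λ p q → X p q + D p q) ≡ 1ℚ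
  shifted X D ∑X≡1 ∑D≡0 = trans (∑₂-+ n X D) (cong₂ _+_ ∑X≡1 ∑D≡0)

¬extreme-⊕⊖ : ∀ {n} {x d : Tensor n} → PlaneStochastic n x → ZeroPlaneSums n d →
  Nonneg (x ⊕ d) → Nonneg (x ⊖ d) → ∀ i j k → ¬ d i j k ≡ 0ℚ →
  ¬ IsExtreme n (PlaneStochastic n) x
¬extreme-⊕⊖ {x = x} {d} xP dZ x⊕d≥0 x⊖d≥0 i j k d≢0 (_ , extreme) =
  d≢0 (+≡-⇒≡0 (x i j k) (d i j k)
         (extreme (x ⊕ d) (x ⊖ d) ½
                  (planeStochastic-⊕ xP dZ x⊕d≥0)
                  (planeStochastic-⊕ xP (zeroPlaneSums-neg dZ) x⊖d≥0)
                  decide-< decide-< midpoint i j k))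
  where
  midpoint : ∀ i j k → x i j k ≡ ½ * (x ⊕ d) i j k + (1ℚ - ½) * (x ⊖ d) i j k
  midpoint i j k = solve 2 (λ y e → y := con ½ :* (y :+ e) :+ con (1ℚ - ½) :* (y :- e))
                           refl (x i j k) (d i j k)

card : ℕ → ℚ
card n = ∑ n (λ _ → 1ℚ)

weight : ∀ {n} → Tensor n → (Fin n → ℚ) → Fin n → ℚ
weight {n} A f k = ∑ n (λ i → f i * ∑ n (λ j → f j * A i j k))

direction : ∀ {n} → Tensor n → (Fin n → ℚ) → Tensor n
direction {n} A f i j k = A i j k * (card n * f i * f j - weight A f k)

∑-*-zero : ∀ n a (f : Fin n → ℚ) → ∑ n f ≡ 0ℚ → ∑ n (λ i → a * f i) ≡ 0ℚ
∑-*-zero n a f ∑f≡0 = trans (∑-*ˡ n a f) (trans (cong (a *_) ∑f≡0) (ℚ.*-zeroʳ a))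

module _ {n} {A : Tensor n} (LS : LineStochastic n A) {f : Fin n → ℚ} (∑f≡0 : ∑ n f ≡ 0ℚ) where

  private
    lineI : ∀ j k → ∑ n (λ i → A i j k) ≡ 1ℚ
    lineI = let (_ , l , _ , _) = LS in l
    lineJ : ∀ i k → ∑ n (λ j → A i j k) ≡ 1ℚ
    lineJ = let (_ , _ , l , _) = LS in l
    lineK : ∀ i j → ∑ n (λ k → A i j k) ≡ 1ℚ
    lineK = let (_ , _ , _ , l) = LS in l

  ∑-weight : ∑ n (weight A f) ≡ 0ℚ
  ∑-weight = begin
    ∑ n (λ k → ∑ n (λ i → f i * ∑ n (λ j → f j * A i j k)))
      ≡⟨ ∑-comm n n (λ k i → f i * ∑ n (λ j → f j * A i j k)) ⟩
    ∑ n (λ i → ∑ n (λ k → f i * ∑ n (λ j → f j * A i j k)))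
      ≡⟨ ∑-cong n (λ i → ∑-*ˡ n (f i) (λ k → ∑ n (λ j → f j * A i j k))) ⟩
    ∑ n (λ i → f i * ∑₂ n (λ k j → f j * A i j k))
      ≡⟨ ∑-cong n (λ i → cong (f i *_) (begin
           ∑₂ n (λ k j → f j * A i j k) ≡⟨ ∑-comm n n (λ k j → f j * A i j k) ⟩
           ∑₂ n (λ j k → f j * A i j k) ≡⟨ ∑₂-rowStochastic n (λ j k → A i j k) f (lineK i) ⟩
           ∑ n f                        ∎)) ⟩
    ∑ n (λ i → f i * ∑ n f)
      ≡⟨ ∑-cong n (λ i → ℚ.*-comm (f i) (∑ n f)) ⟩
    ∑ n (λ i → ∑ n f * f i)
      ≡⟨ ∑-*-zero n (∑ n f) f ∑f≡0 ⟩
    0ℚ ∎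

  direction-zeroPlaneSums : ZeroPlaneSums n (direction A f)
  direction-zeroPlaneSums = planeK , planeI , planeJ
    where
    N : ℚ
    N = card n
    φ : Fin n → ℚ
    φ = weight A f

    planeK : ∀ k → ∑₂ n (λ i j → direction A f i j k) ≡ 0ℚ
    planeK k = begin
      ∑₂ n (λ i j → A i j k * (N * f i * f j - φ k))
        ≡⟨ ∑₂-cong n (λ i j → solve 5 (λ a N x y w → a :* (N :* x :* y :- w)
                                         := N :* (x :* (y :* a)) :- w :* a)
                                       refl (A i j k) N (f i) (f j) (φ k)) ⟩
      ∑₂ n (λ i j → N * (f i * (f j * A i j k)) - φ k * A i j k)
        ≡⟨ ∑₂-- n (λ i j → N * (f i * (f j * A i j k))) (λ i j → φ k * A i j k) ⟩
      ∑₂ n (λ i j → N * (f i * (f j * A i j k))) - ∑₂ n (λ i j → φ k * A i j k)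
        ≡⟨ cong₂ _-_ (∑₂-*ˡ n N (λ i j → f i * (f j * A i j k)))
                     (∑₂-*ˡ n (φ k) (λ i j → A i j k)) ⟩
      N * ∑₂ n (λ i j → f i * (f j * A i j k)) - φ k * ∑₂ n (λ i j → A i j k)
        ≡⟨ cong₂ (λ s t → N * s - φ k * t)
                 (∑-cong n (λ i → ∑-*ˡ n (f i) (λ j → f j * A i j k)))
                 (∑-cong n (λ i → lineJ i k)) ⟩
      N * φ k - φ k * N
        ≡⟨ solve 2 (λ N w → N :* w :- w :* N := con 0ℚ) refl N (φ k) ⟩
      0ℚ ∎

    planeI : ∀ i → ∑₂ n (λ j k → direction A f i j k) ≡ 0ℚ
    planeI i = begin
      ∑₂ n (λ j k → A i j k * (N * f i * f j - φ k))
        ≡⟨ ∑₂-doublyStochastic n (λ j k → A i j k) (λ j → N * f i * f j) φ (lineK i) (lineJ i) ⟩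
      ∑ n (λ j → N * f i * f j) - ∑ n φ
        ≡⟨ cong₂ _-_ (∑-*-zero n (N * f i) f ∑f≡0) ∑-weight ⟩
      0ℚ ∎

    planeJ : ∀ j → ∑₂ n (λ i k → direction A f i j k) ≡ 0ℚ
    planeJ j = begin
      ∑₂ n (λ i k → A i j k * (N * f i * f j - φ k))
        ≡⟨ ∑₂-doublyStochastic n (λ i k → A i j k) (λ i → N * f i * f j) φ (λ i → lineK i j) (lineI j) ⟩
      ∑ n (λ i → N * f i * f j) - ∑ n φ
        ≡⟨ cong₂ _-_ (trans (∑-cong n (λ i → solve 3 (λ N x y → N :* x :* y := (N :* y) :* x) refl N (f i) (f j)))
                            (∑-*-zero n (N * f j) f ∑f≡0))
                     ∑-weight ⟩
      0ℚ ∎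

card-nonNeg : ∀ n → 0ℚ ℚ.≤ card n
card-nonNeg zero    = decide-≤
card-nonNeg (suc n) = ℚ.+-mono-≤ (decide-≤ {0ℚ} {1ℚ}) (card-nonNeg n)

scale-planeStochastic⇒*card≡1 : ∀ {n} {A : Tensor (suc n)} c → LineStochastic (suc n) A →
  PlaneStochastic (suc n) (scale c A) → c * card (suc n) ≡ 1ℚ
scale-planeStochastic⇒*card≡1 {n} {A} c (_ , _ , lineJ , _) (_ , planeK , _) = begin
  c * card (suc n)                       ≡⟨ cong (c *_) (∑-cong (suc n) (λ i → lineJ i zero)) ⟨
  c * ∑₂ (suc n) (λ i j → A i j zero)    ≡⟨ ∑₂-*ˡ (suc n) c (λ i j → A i j zero) ⟨
  ∑₂ (suc n) (λ i j → c * A i j zero)    ≡⟨ planeK zero ⟩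
  1ℚ                                     ∎

e₀-e₁ : ∀ {n} → Fin n → ℚ
e₀-e₁ zero          = 1ℚ
e₀-e₁ (suc zero)    = - 1ℚ
e₀-e₁ (suc (suc _)) = 0ℚ

∑-e₀-e₁ : ∀ m → ∑ (suc (suc m)) e₀-e₁ ≡ 0ℚ
∑-e₀-e₁ m = cong (λ s → 1ℚ + (- 1ℚ + s)) (∑-zero m)

∑-e₀-e₁-* : ∀ m (g : Fin (suc (suc m)) → ℚ) →
  ∑ (suc (suc m)) (λ i → e₀-e₁ i * g i) ≡ g zero - g (suc zero)
∑-e₀-e₁-* m g = begin
  1ℚ * g zero + (- 1ℚ * g (suc zero) + ∑ m (λ i → 0ℚ * g (suc (suc i))))
    ≡⟨ cong (λ s → 1ℚ * g zero + (- 1ℚ * g (suc zero) + s))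
            (trans (∑-cong m (λ i → ℚ.*-zeroˡ (g (suc (suc i))))) (∑-zero m)) ⟩
  1ℚ * g zero + (- 1ℚ * g (suc zero) + 0ℚ)
    ≡⟨ solve 2 (λ a b → con 1ℚ :* a :+ (con (- 1ℚ) :* b :+ con 0ℚ) := a :- b) refl
               (g zero) (g (suc zero)) ⟩
  g zero - g (suc zero) ∎

e₀-e₁-*-bounds : ∀ {n} (i j : Fin n) →
  (0ℚ ℚ.≤ 1ℚ + e₀-e₁ i * e₀-e₁ j) × (0ℚ ℚ.≤ 1ℚ - e₀-e₁ i * e₀-e₁ j)
e₀-e₁-*-bounds zero          zero          = decide-≤ , decide-≤
e₀-e₁-*-bounds zero          (suc zero)    = decide-≤ , decide-≤
e₀-e₁-*-bounds zero          (suc (suc _)) = decide-≤ , decide-≤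
e₀-e₁-*-bounds (suc zero)    zero          = decide-≤ , decide-≤
e₀-e₁-*-bounds (suc zero)    (suc zero)    = decide-≤ , decide-≤
e₀-e₁-*-bounds (suc zero)    (suc (suc _)) = decide-≤ , decide-≤
e₀-e₁-*-bounds (suc (suc _)) zero          = decide-≤ , decide-≤
e₀-e₁-*-bounds (suc (suc _)) (suc zero)    = decide-≤ , decide-≤
e₀-e₁-*-bounds (suc (suc _)) (suc (suc _)) = decide-≤ , decide-≤

ZeroOrOne : ℚ → Set
ZeroOrOne a = a ≡ 0ℚ ⊎ a ≡ 1ℚ

zeroOrOne-difference-bounds : ∀ {a b} → ZeroOrOne a → ZeroOrOne b →
  (0ℚ ℚ.≤ 1ℚ - (a - b)) × (0ℚ ℚ.≤ 1ℚ + (a - b))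
zeroOrOne-difference-bounds (inj₁ refl) (inj₁ refl) = decide-≤ , decide-≤
zeroOrOne-difference-bounds (inj₁ refl) (inj₂ refl) = decide-≤ , decide-≤
zeroOrOne-difference-bounds (inj₂ refl) (inj₁ refl) = decide-≤ , decide-≤
zeroOrOne-difference-bounds (inj₂ refl) (inj₂ refl) = decide-≤ , decide-≤

weight-e₀-e₁ : ∀ m (A : Tensor (suc (suc m))) k →
  weight A e₀-e₁ k ≡ (A zero zero k - A zero (suc zero) k) - (A (suc zero) zero k - A (suc zero) (suc zero) k)
weight-e₀-e₁ m A k = begin
  ∑ n (λ i → e₀-e₁ i * ∑ n (λ j → e₀-e₁ j * A i j k))
    ≡⟨ ∑-e₀-e₁-* m (λ i → ∑ n (λ j → e₀-e₁ j * A i j k)) ⟩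
  ∑ n (λ j → e₀-e₁ j * A zero j k) - ∑ n (λ j → e₀-e₁ j * A (suc zero) j k)
    ≡⟨ cong₂ _-_ (∑-e₀-e₁-* m (λ j → A zero j k)) (∑-e₀-e₁-* m (λ j → A (suc zero) j k)) ⟩
  (A zero zero k - A zero (suc zero) k) - (A (suc zero) zero k - A (suc zero) (suc zero) k) ∎
  where
  n : ℕ
  n = suc (suc m)

weight-e₀-e₁-bounds : ∀ m {A : Tensor (suc (suc m))} → ZeroOne A → ∀ k →
  (0ℚ ℚ.≤ (1ℚ + 1ℚ) - weight A e₀-e₁ k) × (0ℚ ℚ.≤ (1ℚ + 1ℚ) + weight A e₀-e₁ k)
weight-e₀-e₁-bounds m {A} A01 k =
  subst (λ w → (0ℚ ℚ.≤ (1ℚ + 1ℚ) - w) × (0ℚ ℚ.≤ (1ℚ + 1ℚ) + w)) (sym (weight-e₀-e₁ m A k))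
        (bounds (A zero zero k - A zero (suc zero) k) (A (suc zero) zero k - A (suc zero) (suc zero) k)
                (zeroOrOne-difference-bounds (A01 zero zero k) (A01 zero (suc zero) k))
                (zeroOrOne-difference-bounds (A01 (suc zero) zero k) (A01 (suc zero) (suc zero) k)))
  where
  bounds : ∀ p q → (0ℚ ℚ.≤ 1ℚ - p) × (0ℚ ℚ.≤ 1ℚ + p) → (0ℚ ℚ.≤ 1ℚ - q) × (0ℚ ℚ.≤ 1ℚ + q) →
    (0ℚ ℚ.≤ (1ℚ + 1ℚ) - (p - q)) × (0ℚ ℚ.≤ (1ℚ + 1ℚ) + (p - q))
  bounds p q (1-p≥0 , 1+p≥0) (1-q≥0 , 1+q≥0) =
    subst (0ℚ ℚ.≤_) (solve 2 (λ p q → (con 1ℚ :- p) :+ (con 1ℚ :+ q) := (con 1ℚ :+ con 1ℚ) :- (p :- q)) refl p q)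
          (ℚ.+-mono-≤ 1-p≥0 1+q≥0) ,
    subst (0ℚ ℚ.≤_) (solve 2 (λ p q → (con 1ℚ :+ p) :+ (con 1ℚ :- q) := (con 1ℚ :+ con 1ℚ) :+ (p :- q)) refl p q)
          (ℚ.+-mono-≤ 1+p≥0 1-q≥0)

module ZeroOnePerturbation {m} {A : Tensor (suc (suc (suc m)))}
  (LS : LineStochastic (suc (suc (suc m))) A) (A01 : ZeroOne A)
  (xP : PlaneStochastic (suc (suc (suc m))) (scale (inv (suc (suc (suc m)))) A)) where

  n : ℕ
  n = suc (suc (suc m))

  c : ℚ
  c = inv n

  N : ℚ
  N = card n

  φ : Fin n → ℚ
  φ = weight A e₀-e₁

  ε : ℚ
  ε = c * c * ½

  d : Tensor n
  d = scale ε (direction A e₀-e₁)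

  d-zeroPlaneSums : ZeroPlaneSums n d
  d-zeroPlaneSums = zeroPlaneSums-scale ε {d = direction A e₀-e₁}
                      (direction-zeroPlaneSums LS {f = e₀-e₁} (∑-e₀-e₁ (suc m)))

  private
    c*N≡1 : c * N ≡ 1ℚ
    c*N≡1 = scale-planeStochastic⇒*card≡1 c LS xP

    0<c : 0ℚ < c
    0<c = ℚ.positive⁻¹ c {{ℚ.normalize-pos 1 n}}

    0<ε : 0ℚ < ε
    0<ε = *-pos (*-pos 0<c 0<c) decide-<

    0≤A : Nonneg A
    0≤A = proj₁ LS

    c*≡ε*2N* : ∀ a → c * a ≡ ε * (a * (N + N))
    c*≡ε*2N* a = begin
      c * a             ≡⟨ ℚ.*-identityˡ (c * a) ⟨
      1ℚ * (c * a)      ≡⟨ cong (_* (c * a)) c*N≡1 ⟨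
      (c * N) * (c * a) ≡⟨ solve 3 (λ c N a → (c :* N) :* (c :* a) := c :* c :* con ½ :* (a :* (N :+ N))) refl c N a ⟩
      ε * (a * (N + N)) ∎

    N-φ-split : ∀ k → N - φ k ≡ ((1ℚ + 1ℚ) - φ k) + (1ℚ + card m)
    N-φ-split k = solve 2 (λ M w → (con 1ℚ :+ (con 1ℚ :+ (con 1ℚ :+ M))) :- w
                               := ((con 1ℚ :+ con 1ℚ) :- w) :+ (con 1ℚ :+ M)) refl (card m) (φ k)

    N+φ-split : ∀ k → N + φ k ≡ ((1ℚ + 1ℚ) + φ k) + (1ℚ + card m)
    N+φ-split k = solve 2 (λ M w → (con 1ℚ :+ (con 1ℚ :+ (con 1ℚ :+ M))) :+ w
                               := ((con 1ℚ :+ con 1ℚ) :+ w) :+ (con 1ℚ :+ M)) refl (card m) (φ k)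

    0≤1+card : 0ℚ ℚ.≤ 1ℚ + card m
    0≤1+card = ℚ.+-mono-≤ (decide-≤ {0ℚ} {1ℚ}) (card-nonNeg m)

    0≤N-φ : ∀ k → 0ℚ ℚ.≤ N - φ k
    0≤N-φ k = subst (0ℚ ℚ.≤_) (sym (N-φ-split k))
                    (ℚ.+-mono-≤ (proj₁ (weight-e₀-e₁-bounds (suc m) A01 k)) 0≤1+card)

    0≤N+φ : ∀ k → 0ℚ ℚ.≤ N + φ k
    0≤N+φ k = subst (0ℚ ℚ.≤_) (sym (N+φ-split k))
                    (ℚ.+-mono-≤ (proj₂ (weight-e₀-e₁-bounds (suc m) A01 k)) 0≤1+card)

  x⊕d-nonNeg : Nonneg (scale c A ⊕ d)
  x⊕d-nonNeg i j k = subst (0ℚ ℚ.≤_) (sym x⊕d≡) (*-nonNeg (ℚ.<⇒≤ 0<ε) (*-nonNeg (0≤A i j k)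
      (ℚ.+-mono-≤ (*-nonNeg (card-nonNeg n) (proj₁ (e₀-e₁-*-bounds i j))) (0≤N-φ k))))
    where
    a x y : ℚ
    a = A i j k
    x = e₀-e₁ i
    y = e₀-e₁ j
    x⊕d≡ : c * a + ε * (a * (N * x * y - φ k)) ≡ ε * (a * (N * (1ℚ + x * y) + (N - φ k)))
    x⊕d≡ = trans (cong (_+ ε * (a * (N * x * y - φ k))) (c*≡ε*2N* a))
      (solve 6 (λ e a N x y w → e :* (a :* (N :+ N)) :+ e :* (a :* (N :* x :* y :- w))
                           := e :* (a :* (N :* (con 1ℚ :+ x :* y) :+ (N :- w)))) refl ε a N x y (φ k))

  x⊖d-nonNeg : Nonneg (scale c A ⊖ d)
  x⊖d-nonNeg i j k = subst (0ℚ ℚ.≤_) (sym x⊖d≡) (*-nonNeg (ℚ.<⇒≤ 0<ε) (*-nonNeg (0≤A i j k)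
      (ℚ.+-mono-≤ (*-nonNeg (card-nonNeg n) (proj₂ (e₀-e₁-*-bounds i j))) (0≤N+φ k))))
    where
    a x y : ℚ
    a = A i j k
    x = e₀-e₁ i
    y = e₀-e₁ j
    x⊖d≡ : c * a - ε * (a * (N * x * y - φ k)) ≡ ε * (a * (N * (1ℚ - x * y) + (N + φ k)))
    x⊖d≡ = trans (cong (_- ε * (a * (N * x * y - φ k))) (c*≡ε*2N* a))
      (solve 6 (λ e a N x y w → e :* (a :* (N :+ N)) :- e :* (a :* (N :* x :* y :- w))
                           := e :* (a :* (N :* (con 1ℚ :- x :* y) :+ (N :+ w)))) refl ε a N x y (φ k))

  private
    line-hits-one : Σ[ k ∈ Fin n ] A zero zero k ≡ 1ℚ
    line-hits-one = let (_ , _ , _ , lineK) = LS in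
      ∑≡1⇒∃≡1 n (A zero zero) (A01 zero zero) (lineK zero zero)

  k₀ : Fin n
  k₀ = proj₁ line-hits-one

  d≢0 : ¬ d zero zero k₀ ≡ 0ℚ
  d≢0 = ℚ.<⇒≢ 0<d ∘ sym
    where
    0<N-φ : 0ℚ < N * 1ℚ * 1ℚ - φ k₀
    0<N-φ = subst (0ℚ <_)
      (solve 2 (λ M w → ((con 1ℚ :+ con 1ℚ) :- w) :+ (con 1ℚ :+ M)
                     := (con 1ℚ :+ (con 1ℚ :+ (con 1ℚ :+ M))) :* con 1ℚ :* con 1ℚ :- w) refl (card m) (φ k₀))
      (ℚ.+-mono-≤-< (proj₁ (weight-e₀-e₁-bounds (suc m) A01 k₀))
                    (ℚ.+-mono-<-≤ (decide-< {0ℚ} {1ℚ}) (card-nonNeg m)))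
    0<d : 0ℚ < d zero zero k₀
    0<d = *-pos 0<ε (subst (λ a → 0ℚ < a * (N * 1ℚ * 1ℚ - φ k₀)) (sym (proj₂ line-hits-one))
                           (*-pos (decide-< {0ℚ} {1ℚ}) 0<N-φ))

mainTheorem9 : (n : ℕ) → 3 ≤ n → (A : Tensor n) →
    IsExtreme n (LineStochastic n) A → ZeroOne A →
    ¬ IsExtreme n (PlaneStochastic n) (scale (inv n) A)
mainTheorem9 (suc (suc (suc m))) (s≤s (s≤s (s≤s z≤n))) A (LS , _) A01 extreme@(xP , _) =
  ¬extreme-⊕⊖ xP d-zeroPlaneSums x⊕d-nonNeg x⊖d-nonNeg zero zero k₀ d≢0 extreme
  where open ZeroOnePerturbation LS A01 xP
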